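{- Let $d\ge3$ and $n>d$. For $2\le k\le d$ define $r_k=\lfloor n^{d-1}(n-1)^{k+1-2^k}\rfloor$. Then every $d$-dimensional latin hypercube $Q$ of order $n$ contains at least $$(d+1)n^{2d}-(d-1)\left(n^{2d-1}+n^d\right)-d\,n^{d+1}+n\sum_{k=2}^{d}\binom{d}{k}(n-d)^{2^k-1}r_k(r_k-1)$$ cuboctahedra.
   Context: A $d$-dimensional latin hypercube of order $n$ is an array $Q=(q_\alpha)$ indexed by $\alpha\in\{0,\ldots,n-1\}^d$ with entries in $\{0,\ldots,n-1\}$ such that any two indices differing in exactly one coordinate carry different symbols. A cuboctahedron in $Q$ is a tuple consisting of $d$ ordered pairs $(a^i_1,a^i_2)$ and $d$ ordered pairs $(b^i_1,b^i_2)$, $i=1,\ldots,d$, of elements of $\{0,\ldots,n-1\}$, such that $q_{a^1_{j_1},\ldots,a^d_{j_d}}=q_{b^1_{j_1},\ldots,b^d_{j_d}}$ for all $j_1,\ldots,j_d\in\{1,2\}$; cuboctahedra are counted as such tuples. -}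

module Defs where

open import Data.Nat as ℕ using (ℕ; zero; suc; _∸_; _^_)
open import Data.Nat.DivMod using (_/_)
open import Data.Nat.Combinatorics using (_C_)
open import Data.Integer as ℤ using (ℤ; +_; _+_; _-_; _*_)
open import Data.Fin using (Fin; zero; suc)
open import Data.Vec using (Vec; lookup; zipWith)
open import Data.List using (List; map; drop; upTo; foldr)
open import Data.Product using (Σ; ∃; _×_; _,_; proj₁; proj₂)
open import Relation.Binary.PropositionalEquality using (_≡_; _≢_)

Index : ℕ → ℕ → Set
Index d n = Vec (Fin n) d

DifferInExactlyOne : ∀ {d n} → Index d n → Index d n → Set
DifferInExactlyOne {d} α β =
  ∃ λ (i : Fin d) → (lookup α i ≢ lookup β i) ×
    ((j : Fin d) → j ≢ i → lookup α j ≡ lookup β j)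

IsLatin : ∀ {d n} → (Index d n → Fin n) → Set
IsLatin {d} {n} q = (α β : Index d n) → DifferInExactlyOne α β → q α ≢ q β

LatinHypercube : ℕ → ℕ → Set
LatinHypercube d n = Σ (Index d n → Fin n) IsLatin

-- A candidate cuboctahedron: d ordered pairs (a^i_1,a^i_2) and d ordered
-- pairs (b^i_1,b^i_2).
Tuple : ℕ → ℕ → Set
Tuple d n = Vec (Fin n × Fin n) d × Vec (Fin n × Fin n) d

pick : ∀ {n} → Fin n × Fin n → Fin 2 → Fin n
pick p zero = proj₁ p
pick p (suc _) = proj₂ p

IsCuboctahedron : ∀ {d n} → (Index d n → Fin n) → Tuple d n → Set
IsCuboctahedron {d} q (a , b) =
  (j : Vec (Fin 2) d) → q (zipWith pick a j) ≡ q (zipWith pick b j)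

-- floor division (divisor 0 never occurs in use)
floorDiv : ℕ → ℕ → ℕ
floorDiv a zero = 0
floorDiv a (suc b) = a / suc b

-- r_k = ⌊ n^(d-1) (n-1)^(k+1-2^k) ⌋ = ⌊ n^(d-1) / (n-1)^(2^k-k-1) ⌋  (k ≥ 2)
r : ℕ → ℕ → ℕ → ℕ
r d n k = floorDiv (n ^ (d ∸ 1)) ((n ∸ 1) ^ ((2 ^ k) ∸ k ∸ 1))

sumℤ : List ℤ → ℤ
sumℤ = foldr _+_ (+ 0)

term : ℕ → ℕ → ℕ → ℤ
term d n k = + (d C k) * (+ ((n ∸ d) ^ ((2 ^ k) ∸ 1))) * (+ r d n k * (+ r d n k - + 1))

bound : ℕ → ℕ → ℤ
bound d n =
  + ((suc d) ℕ.* n ^ (2 ℕ.* d))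
  - + (d ∸ 1) * (+ (n ^ (2 ℕ.* d ∸ 1)) + + (n ^ d))
  - + d * + (n ^ (suc d))
  + + n * sumℤ (map (term d n) (drop 2 (upTo (suc d))))

-- Sort the candidate tuples by their shape D ∈ {0,1}^d, recording which of the d coordinate pairs
-- are distinct.  There are n^d (n-1)^k boxes of a shape with k distinct pairs, each with 2^k
-- corners.  By the latin property the values of Q on the corners of such a box are determined by a
-- code with at most M_k = n (n-1)^(2^k-1) values: the value at one corner, and across each distinct
-- direction the values on the far face written relative to the (different) values on the near face.
-- Two boxes of the same shape and code form a cuboctahedron.  If T objects fall into M classes and
-- M r ≤ T, then, as (c - r)(c - r - 1) ≥ 0 for every class size c, there are at least
-- T + M r (r - 1) ordered pairs inside classes.  With r = r_k and a binomial sum over the shapes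
-- this gives n^(2d) + n Σ_k C(d,k) (n-1)^(2^k-1) r_k (r_k - 1) cuboctahedra, which exceeds the
-- stated bound: n - d ≤ n - 1, and r_0 = r_1 = n^(d-1) account for the remaining terms.

module Submission where

open import Defs
open import Algebra.Properties.CommutativeSemigroup using (interchange)
open import Data.Bool using (Bool; true; false; not; if_then_else_)
open import Data.Empty using (⊥; ⊥-elim)
open import Data.Fin using (Fin; zero; suc; punchOut; punchIn; combine)
open import Data.Fin.Properties
  using (punchOut-injective; punchIn-injective; punchInᵢ≢i; combine-injective)
  renaming (_≟_ to _≟ᶠ_)
open import Data.List
  using (List; []; _∷_; _++_; map; filter; concatMap; length; allFin; upTo; drop; cartesianProductWith)
open import Data.List.Properties using (map-applyUpTo; upTo-∷ʳ; length-++; length-map; map-cong; map-tabulate; length-tabulate; map-++; map-∘)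
open import Data.Nat.ListAction.Properties using (sum-++)
open import Data.List.Membership.Propositional using (_∈_)
open import Data.List.Relation.Unary.All as All using (All; []; _∷_)
import Data.List.Relation.Unary.All.Properties as All
open import Data.List.Relation.Unary.Unique.Propositional using (Unique; []; _∷_)
import Data.List.Relation.Unary.Unique.Propositional.Properties as Unique
open import Data.Nat using (ℕ; zero; suc; _+_; _*_; _∸_; _^_; _≤_; _<_; z≤n; s≤s)
open import Data.Nat.ListAction using (sum)
open import Data.Nat.Combinatorics using (_C_; nCk+nC[k+1]≡[n+1]C[k+1]; k>n⇒nCk≡0; nC1≡n)
open import Data.Nat.DivMod using (_/_; m/n*n≤m; n/1≡n)
open import Data.Nat.Properties
open import Data.Nat.Tactic.RingSolver using (solve-∀)
open import Data.Product using (∃; _×_; _,_; proj₁; proj₂)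
open import Data.Vec using (Vec; []; _∷_; head; lookup; zipWith)
open import Data.Vec.Properties using (∷-injective; ∷-injectiveʳ)
open import Function using (_∘_; id)
open import Relation.Nullary using (yes; no; does)
open import Relation.Binary.PropositionalEquality

module _ {A : Set} where

  sum-map-+ : ∀ (f g : A → ℕ) xs →
    sum (map (λ x → f x + g x) xs) ≡ sum (map f xs) + sum (map g xs)
  sum-map-+ f g []       = refl
  sum-map-+ f g (x ∷ xs) =
    trans (cong ((f x + g x) +_) (sum-map-+ f g xs)) (interchange +-commutativeSemigroup (f x) (g x) _ _)

  *-distribˡ-sum-map : ∀ c (f : A → ℕ) xs → c * sum (map f xs) ≡ sum (map (λ x → c * f x) xs)
  *-distribˡ-sum-map c f []       = *-zeroʳ c
  *-distribˡ-sum-map c f (x ∷ xs) =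
    trans (*-distribˡ-+ c (f x) _) (cong ((c * f x) +_) (*-distribˡ-sum-map c f xs))

  sum-map-mono-≤ : ∀ {f g : A → ℕ} → (∀ x → f x ≤ g x) → ∀ xs → sum (map f xs) ≤ sum (map g xs)
  sum-map-mono-≤ f≤g []       = z≤n
  sum-map-mono-≤ f≤g (x ∷ xs) = +-mono-≤ (f≤g x) (sum-map-mono-≤ f≤g xs)

  sum-map-const : ∀ k (xs : List A) → sum (map (λ _ → k) xs) ≡ length xs * k
  sum-map-const k []       = refl
  sum-map-const k (x ∷ xs) = cong (k +_) (sum-map-const k xs)

  length-concatMap : ∀ {B : Set} (f : A → List B) xs →
    length (concatMap f xs) ≡ sum (map (length ∘ f) xs)
  length-concatMap f []       = refl
  length-concatMap f (x ∷ xs) = trans (length-++ (f x)) (cong (length (f x) +_) (length-concatMap f xs))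

  Unique-concatMap : ∀ {B : Set} (f : A → List B) (key : B → A) {xs} → Unique xs →
    (∀ x → Unique (f x)) → (∀ x → All (λ y → key y ≡ x) (f x)) → Unique (concatMap f xs)
  Unique-concatMap f key {[]}     []         uniq keyed = []
  Unique-concatMap f key {x ∷ xs} (x∉ ∷ uxs) uniq keyed =
    Unique.++⁺ (uniq x) (Unique-concatMap f key uxs uniq keyed) disjoint
    where
    keys≢ : All (λ y → key y ≢ x) (concatMap f xs)
    keys≢ = All.concat⁺ (All.map⁺ (All.map
      (λ {x′} x≢x′ → All.map (λ k≡x′ k≡x → x≢x′ (trans (sym k≡x) k≡x′)) (keyed x′)) x∉))
    disjoint : ∀ {y} → y ∈ f x × y ∈ concatMap f xs → ⊥
    disjoint (y∈fx , y∈rest) = All.lookup keys≢ y∈rest (All.lookup (keyed x) y∈fx)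

length-cartesianProductWith : ∀ {A B C : Set} (f : A → B → C) xs ys →
  length (cartesianProductWith f xs ys) ≡ length xs * length ys
length-cartesianProductWith f []       ys = refl
length-cartesianProductWith f (x ∷ xs) ys =
  trans (length-++ (map (f x) ys)) (cong₂ _+_ (length-map (f x) ys) (length-cartesianProductWith f xs ys))

sum-map-allFin-const : ∀ M k → sum (map (λ _ → k) (allFin M)) ≡ M * k
sum-map-allFin-const M k = trans (sum-map-const k (allFin M)) (cong (_* k) (length-tabulate {n = M} id))

sum-map-allFin-suc : ∀ {M} (h : Fin (suc M) → ℕ) →
  sum (map h (allFin (suc M))) ≡ h zero + sum (map (h ∘ suc) (allFin M))
sum-map-allFin-suc {M} h =
  cong (λ xs → h zero + sum xs) (trans (map-tabulate suc h) (sym (map-tabulate id (h ∘ suc))))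

-- Ordered pairs inside the fibres of a map

[2r+1]c≤c*c+r[r+1] : ∀ c r → (2 * r + 1) * c ≤ c * c + r * (r + 1)
[2r+1]c≤c*c+r[r+1] c r with c ≤? r
... | yes c≤r with e , refl ← m≤n⇒∃[o]m+o≡n c≤r =
  subst ((2 * (c + e) + 1) * c ≤_) (slack c e) (m≤m+n _ (e * suc e))
  where slack : ∀ c e → (2 * (c + e) + 1) * c + e * suc e ≡ c * c + (c + e) * ((c + e) + 1)
        slack = solve-∀
... | no c≰r with e , refl ← m≤n⇒∃[o]m+o≡n (≰⇒> c≰r) =
  subst ((2 * r + 1) * (suc r + e) ≤_) (slack r e) (m≤m+n _ (suc e * e))
  where slack : ∀ r e → (2 * r + 1) * (suc r + e) + suc e * e ≡ (suc r + e) * (suc r + e) + r * (r + 1)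
        slack = solve-∀

[2r+1]T≤P+M[r[r+1]]⇒T+M[r[r∸1]]≤P : ∀ M T P r → M * r ≤ T → (2 * r + 1) * T ≤ P + M * (r * (r + 1)) →
  T + M * (r * (r ∸ 1)) ≤ P
[2r+1]T≤P+M[r[r+1]]⇒T+M[r[r∸1]]≤P M T P zero _ h = begin
  T + M * 0  ≡⟨ cong (T +_) (*-zeroʳ M) ⟩
  T + 0      ≤⟨ h ⟩
  P + M * 0  ≡⟨ trans (cong (P +_) (*-zeroʳ M)) (+-identityʳ P) ⟩
  P          ∎
  where open ≤-Reasoning
[2r+1]T≤P+M[r[r+1]]⇒T+M[r[r∸1]]≤P M T P (suc s) Mr≤T h = +-cancelʳ-≤ K _ P (begin
  T + M * (suc s * s) + K          ≡⟨ eq₁ T M s ⟩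
  T + 2 * suc s * (M * suc s)      ≤⟨ +-monoʳ-≤ T (*-monoʳ-≤ (2 * suc s) Mr≤T) ⟩
  T + 2 * suc s * T                ≡⟨ eq₂ T s ⟩
  (2 * suc s + 1) * T              ≤⟨ h ⟩
  P + K                            ∎)
  where
  open ≤-Reasoning
  K : ℕ
  K = M * (suc s * (suc s + 1))
  eq₁ : ∀ T M s → T + M * (suc s * s) + M * (suc s * (suc s + 1)) ≡ T + 2 * suc s * (M * suc s)
  eq₁ = solve-∀
  eq₂ : ∀ T s → T + 2 * suc s * T ≡ (2 * suc s + 1) * T
  eq₂ = solve-∀

δ : ∀ {M} → Fin M → Fin M → ℕ
δ w v = if does (w ≟ᶠ v) then 1 else 0

sum-map-δ : ∀ {M} (w : Fin M) (h : Fin M → ℕ) → sum (map (λ v → δ w v * h v) (allFin M)) ≡ h w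
sum-map-δ {suc M} zero h = begin
  sum (map (λ v → δ zero v * h v) (allFin (suc M)))  ≡⟨ sum-map-allFin-suc (λ v → δ zero v * h v) ⟩
  h zero + 0 + sum (map (λ _ → 0) (allFin M))        ≡⟨ cong₂ _+_ (+-identityʳ (h zero)) (sum-map-allFin-const M 0) ⟩
  h zero + M * 0                                     ≡⟨ cong (h zero +_) (*-zeroʳ M) ⟩
  h zero + 0                                         ≡⟨ +-identityʳ (h zero) ⟩
  h zero                                             ∎
  where open ≡-Reasoning
sum-map-δ {suc M} (suc w) h = trans (sum-map-allFin-suc (λ v → δ (suc w) v * h v)) (sum-map-δ w (h ∘ suc))

module Fibres {A : Set} {M : ℕ} (g : A → Fin M) where

  fibreSize : List A → Fin M → ℕ
  fibreSize xs v = length (filter (λ a → g a ≟ᶠ v) xs)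

  sameFibrePairs : List A → List (A × A)
  sameFibrePairs xs = concatMap (λ a → map (a ,_) (filter (λ b → g b ≟ᶠ g a) xs)) xs

  fibreSize-∷ : ∀ y ys v → fibreSize (y ∷ ys) v ≡ δ (g y) v + fibreSize ys v
  fibreSize-∷ y ys v with g y ≟ᶠ v
  ... | yes _ = refl
  ... | no _  = refl

  sum-map-by-fibres : ∀ (h : Fin M → ℕ) ys →
    sum (map (h ∘ g) ys) ≡ sum (map (λ v → fibreSize ys v * h v) (allFin M))
  sum-map-by-fibres h []       = sym (trans (sum-map-allFin-const M 0) (*-zeroʳ M))
  sum-map-by-fibres h (y ∷ ys) = begin
    h (g y) + sum (map (h ∘ g) ys)
      ≡⟨ cong₂ _+_ (sym (sum-map-δ (g y) h)) (sum-map-by-fibres h ys) ⟩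
    sum (map (λ v → δ (g y) v * h v) (allFin M)) + sum (map (λ v → fibreSize ys v * h v) (allFin M))
      ≡⟨ sum-map-+ _ _ (allFin M) ⟨
    sum (map (λ v → δ (g y) v * h v + fibreSize ys v * h v) (allFin M))
      ≡⟨ cong sum (map-cong split (allFin M)) ⟨
    sum (map (λ v → fibreSize (y ∷ ys) v * h v) (allFin M))
      ∎
    where
    open ≡-Reasoning
    split : ∀ v → fibreSize (y ∷ ys) v * h v ≡ δ (g y) v * h v + fibreSize ys v * h v
    split v = trans (cong (_* h v) (fibreSize-∷ y ys v)) (*-distribʳ-+ (h v) (δ (g y) v) (fibreSize ys v))

  length≡sum-fibreSize : ∀ xs → length xs ≡ sum (map (fibreSize xs) (allFin M))
  length≡sum-fibreSize xs = begin
    length xs                                            ≡⟨ *-identityʳ _ ⟨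
    length xs * 1                                        ≡⟨ sum-map-const 1 xs ⟨
    sum (map (λ _ → 1) xs)                               ≡⟨ sum-map-by-fibres (λ _ → 1) xs ⟩
    sum (map (λ v → fibreSize xs v * 1) (allFin M))      ≡⟨ cong sum (map-cong (λ v → *-identityʳ _) (allFin M)) ⟩
    sum (map (fibreSize xs) (allFin M))                  ∎
    where open ≡-Reasoning

  length-sameFibrePairs : ∀ xs →
    length (sameFibrePairs xs) ≡ sum (map (λ v → fibreSize xs v * fibreSize xs v) (allFin M))
  length-sameFibrePairs xs = begin
    length (sameFibrePairs xs)                  ≡⟨ length-concatMap _ xs ⟩
    sum (map (λ a → length (map (a ,_) (filter (λ b → g b ≟ᶠ g a) xs))) xs)
      ≡⟨ cong sum (map-cong (λ a → length-map (a ,_) (filter (λ b → g b ≟ᶠ g a) xs)) xs) ⟩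
    sum (map (fibreSize xs ∘ g) xs)             ≡⟨ sum-map-by-fibres (fibreSize xs) xs ⟩
    sum (map (λ v → fibreSize xs v * fibreSize xs v) (allFin M)) ∎
    where open ≡-Reasoning

  sameFibrePairs-unique : ∀ {xs} → Unique xs → Unique (sameFibrePairs xs)
  sameFibrePairs-unique uniq = Unique-concatMap _ proj₁ uniq
    (λ a → Unique.map⁺ (cong proj₂) (Unique.filter⁺ _ uniq))
    (λ a → All.map⁺ (All.universal (λ _ → refl) _))

  sameFibrePairs⁺ : ∀ {P : A → Set} {xs} → All P xs →
    All (λ ab → P (proj₁ ab) × P (proj₂ ab) × g (proj₂ ab) ≡ g (proj₁ ab)) (sameFibrePairs xs)
  sameFibrePairs⁺ {xs = xs} ps = All.concat⁺ (All.map⁺ (All.map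
    (λ {a} pa → All.map⁺ (All.map (λ (pb , same) → pa , pb , same)
      (All.zip (All.filter⁺ (λ b → g b ≟ᶠ g a) ps , All.all-filter (λ b → g b ≟ᶠ g a) xs))))
    ps))

  sameFibrePairs-length-≥ : ∀ xs r → M * r ≤ length xs →
    length xs + M * (r * (r ∸ 1)) ≤ length (sameFibrePairs xs)
  sameFibrePairs-length-≥ xs r Mr≤T =
    [2r+1]T≤P+M[r[r+1]]⇒T+M[r[r∸1]]≤P M (length xs) _ r Mr≤T (begin
      (2 * r + 1) * length xs                                 ≡⟨ cong ((2 * r + 1) *_) (length≡sum-fibreSize xs) ⟩
      (2 * r + 1) * sum (map c (allFin M))                    ≡⟨ *-distribˡ-sum-map (2 * r + 1) c (allFin M) ⟩
      sum (map (λ v → (2 * r + 1) * c v) (allFin M))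
        ≤⟨ sum-map-mono-≤ (λ v → [2r+1]c≤c*c+r[r+1] (c v) r) (allFin M) ⟩
      sum (map (λ v → c v * c v + r * (r + 1)) (allFin M))    ≡⟨ sum-map-+ _ _ (allFin M) ⟩
      sum (map (λ v → c v * c v) (allFin M)) + sum (map (λ _ → r * (r + 1)) (allFin M))
        ≡⟨ cong₂ _+_ (length-sameFibrePairs xs) (sym (sum-map-allFin-const M (r * (r + 1)))) ⟨
      length (sameFibrePairs xs) + M * (r * (r + 1))          ∎)
    where
    open ≤-Reasoning
    c : Fin M → ℕ
    c = fibreSize xs

-- Boxes in a latin hypercube

Cube : ℕ → ℕ → Set
Cube d n = Index d n → Fin n

slice : ∀ {d n} → Cube (suc d) n → Fin n → Cube d n
slice q x α = q (x ∷ α)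

IsLatin-slice : ∀ {d n} {q : Cube (suc d) n} → IsLatin q → ∀ x → IsLatin (slice q x)
IsLatin-slice latin x α β (i , αᵢ≢βᵢ , rest) = latin (x ∷ α) (x ∷ β) (suc i , αᵢ≢βᵢ , rest′)
  where
  rest′ : ∀ j → j ≢ suc i → lookup (x ∷ α) j ≡ lookup (x ∷ β) j
  rest′ zero    _     = refl
  rest′ (suc j) j≢1+i = rest j (j≢1+i ∘ cong suc)

IsLatin-adjacent : ∀ {d n} {q : Cube (suc d) n} → IsLatin q → ∀ {x y} β → x ≢ y → q (x ∷ β) ≢ q (y ∷ β)
IsLatin-adjacent latin {x} {y} β x≢y = latin (x ∷ β) (y ∷ β) (zero , x≢y , rest)
  where
  rest : ∀ j → j ≢ zero → lookup (x ∷ β) j ≡ lookup (y ∷ β) j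
  rest zero    j≢0 = ⊥-elim (j≢0 refl)
  rest (suc j) _   = refl

corner : ∀ {d n} → Vec (Fin n × Fin n) d → Vec (Fin 2) d → Index d n
corner = zipWith pick

data HasShape {n} : ∀ {d} → Vec Bool d → Vec (Fin n × Fin n) d → Set where
  []       : HasShape [] []
  same     : ∀ {d} {D : Vec Bool d} {t} x → HasShape D t → HasShape (false ∷ D) ((x , x) ∷ t)
  distinct : ∀ {d} {D : Vec Bool d} {t} x y → x ≢ y → HasShape D t → HasShape (true ∷ D) ((x , y) ∷ t)

#true : ∀ {d} → Vec Bool d → ℕ
#true []          = 0
#true (false ∷ D) = #true D
#true (true ∷ D)  = suc (#true D)

allBoolVecs : ∀ d → List (Vec Bool d)
allBoolVecs zero    = [] ∷ []
allBoolVecs (suc d) = map (false ∷_) (allBoolVecs d) ++ map (true ∷_) (allBoolVecs d)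

allBoolVecs-unique : ∀ d → Unique (allBoolVecs d)
allBoolVecs-unique zero    = [] ∷ []
allBoolVecs-unique (suc d) =
  Unique.++⁺ (Unique.map⁺ ∷-injectiveʳ (allBoolVecs-unique d)) (Unique.map⁺ ∷-injectiveʳ (allBoolVecs-unique d))
    λ (D∈F , D∈T) → false≢true (trans (sym (All.lookup (heads false) D∈F)) (All.lookup (heads true) D∈T))
  where
  heads : ∀ b → All (λ D → head D ≡ b) (map (b ∷_) (allBoolVecs d))
  heads b = All.map⁺ (All.universal (λ _ → refl) (allBoolVecs d))
  false≢true : false ≢ true
  false≢true ()

sum-map-allBoolVecs-suc : ∀ d (h : Vec Bool (suc d) → ℕ) →
  sum (map h (allBoolVecs (suc d))) ≡ sum (map (h ∘ (false ∷_)) (allBoolVecs d)) + sum (map (h ∘ (true ∷_)) (allBoolVecs d))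
sum-map-allBoolVecs-suc d h = begin
  sum (map h (map (false ∷_) A ++ map (true ∷_) A))            ≡⟨ cong sum (map-++ h (map (false ∷_) A) _) ⟩
  sum (map h (map (false ∷_) A) ++ map h (map (true ∷_) A))    ≡⟨ sum-++ (map h (map (false ∷_) A)) _ ⟩
  sum (map h (map (false ∷_) A)) + sum (map h (map (true ∷_) A))
    ≡⟨ cong₂ _+_ (cong sum (map-∘ A)) (cong sum (map-∘ A)) ⟨
  sum (map (h ∘ (false ∷_)) A) + sum (map (h ∘ (true ∷_)) A)  ∎
  where
  open ≡-Reasoning
  A : List (Vec Bool d)
  A = allBoolVecs d

distinctPairs : ∀ {k} → List (Fin (suc k) × Fin (suc k))
distinctPairs {k} = cartesianProductWith (λ x z → x , punchIn x z) (allFin (suc k)) (allFin k)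

distinctPairs-distinct : ∀ {k} → All (λ p → proj₁ p ≢ proj₂ p) (distinctPairs {k})
distinctPairs-distinct {k} = All.cartesianProductWith⁺ (setoid _) (setoid _) _ (allFin (suc k)) (allFin k)
  (λ {x} {z} _ _ → punchInᵢ≢i x z ∘ sym)

distinctPairs-unique : ∀ {k} → Unique (distinctPairs {k})
distinctPairs-unique {k} = Unique.cartesianProductWith⁺ _ pair-injective (Unique.allFin⁺ (suc k)) (Unique.allFin⁺ k)
  where
  pair-injective : ∀ {w x y z} → (w , punchIn w y) ≡ (x , punchIn x z) → w ≡ x × y ≡ z
  pair-injective {w} {y = y} {z} eq with refl ← cong proj₁ eq = refl , punchIn-injective w y z (cong proj₂ eq)

boxes : ∀ {k d} → Vec Bool d → List (Vec (Fin (suc k) × Fin (suc k)) d)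
boxes []          = [] ∷ []
boxes (false ∷ D) = cartesianProductWith (λ x t → (x , x) ∷ t) (allFin _) (boxes D)
boxes (true ∷ D)  = cartesianProductWith _∷_ distinctPairs (boxes D)

boxes-HasShape : ∀ {k d} (D : Vec Bool d) → All (HasShape D) (boxes {k} D)
boxes-HasShape []          = [] ∷ []
boxes-HasShape (false ∷ D) = All.cartesianProductWith⁺ (setoid _) (setoid _) _ (allFin _) (boxes D)
  (λ {x} _ t∈ → same x (All.lookup (boxes-HasShape D) t∈))
boxes-HasShape (true ∷ D)  = All.cartesianProductWith⁺ (setoid _) (setoid _) _ distinctPairs (boxes D)
  (λ {p} p∈ t∈ → distinct (proj₁ p) (proj₂ p) (All.lookup distinctPairs-distinct p∈) (All.lookup (boxes-HasShape D) t∈))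

boxes-unique : ∀ {k d} (D : Vec Bool d) → Unique (boxes {k} D)
boxes-unique []          = [] ∷ []
boxes-unique (false ∷ D) = Unique.cartesianProductWith⁺ _ diagonal-∷-injective (Unique.allFin⁺ _) (boxes-unique D)
  where
  diagonal-∷-injective : ∀ {w x y z} → (w , w) ∷ y ≡ (x , x) ∷ z → w ≡ x × y ≡ z
  diagonal-∷-injective refl = refl , refl
boxes-unique (true ∷ D)  = Unique.cartesianProductWith⁺ _ ∷-injective distinctPairs-unique (boxes-unique D)

length-boxes : ∀ {k d} (D : Vec Bool d) → length (boxes {k} D) ≡ suc k ^ d * k ^ #true D
length-boxes []                  = refl
length-boxes {k} {suc d} (false ∷ D) = begin
  length (cartesianProductWith (λ x t → (x , x) ∷ t) (allFin (suc k)) (boxes {k} D))  ≡⟨ length-cartesianProductWith (λ x t → (x , x) ∷ t) (allFin (suc k)) (boxes {k} D) ⟩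
  length (allFin (suc k)) * length (boxes {k} D)                  ≡⟨ cong₂ _*_ (length-tabulate {n = suc k} id) (length-boxes {k} D) ⟩
  suc k * (suc k ^ d * k ^ #true D)                           ≡⟨ *-assoc (suc k) (suc k ^ d) (k ^ #true D) ⟨
  suc k ^ suc d * k ^ #true D                                 ∎
  where open ≡-Reasoning
length-boxes {k} {suc d} (true ∷ D)  = begin
  length (cartesianProductWith _∷_ (distinctPairs {k}) (boxes {k} D))   ≡⟨ length-cartesianProductWith _∷_ (distinctPairs {k}) (boxes {k} D) ⟩
  length (distinctPairs {k}) * length (boxes {k} D)               ≡⟨ cong₂ _*_ length-distinctPairs (length-boxes {k} D) ⟩
  suc k * k * (suc k ^ d * k ^ #true D)                       ≡⟨ interchange *-commutativeSemigroup (suc k) k (suc k ^ d) (k ^ #true D) ⟩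
  suc k ^ suc d * k ^ suc (#true D)                           ∎
  where
  open ≡-Reasoning
  length-distinctPairs : length (distinctPairs {k}) ≡ suc k * k
  length-distinctPairs = trans (length-cartesianProductWith _ (allFin (suc k)) (allFin k))
    (cong₂ _*_ (length-tabulate {n = suc k} id) (length-tabulate {n = k} id))

shapeOf : ∀ {n d} → Vec (Fin n × Fin n) d → Vec Bool d
shapeOf []            = []
shapeOf ((x , y) ∷ t) = not (does (x ≟ᶠ y)) ∷ shapeOf t

shapeOf-HasShape : ∀ {n d} {D : Vec Bool d} {t : Vec (Fin n × Fin n) d} → HasShape D t → shapeOf t ≡ D
shapeOf-HasShape []                   = refl
shapeOf-HasShape (same x s) with x ≟ᶠ x
... | yes _  = cong (false ∷_) (shapeOf-HasShape s)
... | no x≢x = ⊥-elim (x≢x refl)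
shapeOf-HasShape (distinct x y x≢y s) with x ≟ᶠ y
... | yes x≡y = ⊥-elim (x≢y x≡y)
... | no _    = cong (true ∷_) (shapeOf-HasShape s)

sum-map-upTo-suc : ∀ (f : ℕ → ℕ) k → sum (map f (upTo (suc k))) ≡ f 0 + sum (map (f ∘ suc) (upTo k))
sum-map-upTo-suc f k =
  cong (λ xs → f 0 + sum xs) (trans (map-applyUpTo suc f k) (sym (map-applyUpTo id (f ∘ suc) k)))

sum-map-upTo-∷ʳ : ∀ (f : ℕ → ℕ) k → sum (map f (upTo (suc k))) ≡ sum (map f (upTo k)) + f k
sum-map-upTo-∷ʳ f k = begin
  sum (map f (upTo (suc k)))              ≡⟨ cong (sum ∘ map f) (upTo-∷ʳ k) ⟨
  sum (map f (upTo k ++ k ∷ []))          ≡⟨ cong sum (map-++ f (upTo k) (k ∷ [])) ⟩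
  sum (map f (upTo k) ++ f k ∷ [])        ≡⟨ sum-++ (map f (upTo k)) (f k ∷ []) ⟩
  sum (map f (upTo k)) + (f k + 0)        ≡⟨ cong (sum (map f (upTo k)) +_) (+-identityʳ (f k)) ⟩
  sum (map f (upTo k)) + f k              ∎
  where open ≡-Reasoning

pascal-sum : ∀ d (h : ℕ → ℕ) →
  sum (map (λ k → (suc d C k) * h k) (upTo (suc (suc d)))) ≡
  sum (map (λ k → (d C k) * h k) (upTo (suc d))) + sum (map (λ k → (d C k) * h (suc k)) (upTo (suc d)))
pascal-sum d h = begin
  sum (map (λ k → (suc d C k) * h k) (upTo (suc (suc d))))
    ≡⟨ sum-map-upTo-suc (λ k → (suc d C k) * h k) (suc d) ⟩
  1 * h 0 + sum (map (λ k → (suc d C suc k) * h (suc k)) (upTo (suc d)))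
    ≡⟨ cong (1 * h 0 +_) (cong sum (map-cong pascal (upTo (suc d)))) ⟩
  1 * h 0 + sum (map (λ k → (d C k) * h (suc k) + (d C suc k) * h (suc k)) (upTo (suc d)))
    ≡⟨ cong (1 * h 0 +_) (sum-map-+ (λ k → (d C k) * h (suc k)) (λ k → (d C suc k) * h (suc k)) (upTo (suc d))) ⟩
  1 * h 0 + (Y + sum (map (λ k → (d C suc k) * h (suc k)) (upTo (suc d))))
    ≡⟨ cong (λ z → 1 * h 0 + (Y + z)) (sum-map-upTo-∷ʳ (λ k → (d C suc k) * h (suc k)) d) ⟩
  1 * h 0 + (Y + (X + (d C suc d) * h (suc d)))
    ≡⟨ cong (λ c → 1 * h 0 + (Y + (X + c * h (suc d)))) (k>n⇒nCk≡0 (n<1+n d)) ⟩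
  1 * h 0 + (Y + (X + 0))
    ≡⟨ rearrange (1 * h 0) X Y ⟩
  (1 * h 0 + X) + Y
    ≡⟨ cong (_+ Y) (sum-map-upTo-suc (λ k → (d C k) * h k) d) ⟨
  sum (map (λ k → (d C k) * h k) (upTo (suc d))) + Y ∎
  where
  open ≡-Reasoning
  X Y : ℕ
  X = sum (map (λ k → (d C suc k) * h (suc k)) (upTo d))
  Y = sum (map (λ k → (d C k) * h (suc k)) (upTo (suc d)))
  pascal : ∀ k → (suc d C suc k) * h (suc k) ≡ (d C k) * h (suc k) + (d C suc k) * h (suc k)
  pascal k = trans (cong (_* h (suc k)) (sym (nCk+nC[k+1]≡[n+1]C[k+1] d k))) (*-distribʳ-+ (h (suc k)) (d C k) _)
  rearrange : ∀ a x y → a + (y + (x + 0)) ≡ (a + x) + y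
  rearrange = solve-∀

binomial-sum : ∀ d (h : ℕ → ℕ) →
  sum (map (h ∘ #true) (allBoolVecs d)) ≡ sum (map (λ k → (d C k) * h k) (upTo (suc d)))
binomial-sum zero    h = cong (_+ 0) (sym (*-identityˡ (h 0)))
binomial-sum (suc d) h = begin
  sum (map (h ∘ #true) (allBoolVecs (suc d)))
    ≡⟨ sum-map-allBoolVecs-suc d (h ∘ #true) ⟩
  sum (map (h ∘ #true) (allBoolVecs d)) + sum (map (h ∘ suc ∘ #true) (allBoolVecs d))
    ≡⟨ cong₂ _+_ (binomial-sum d h) (binomial-sum d (h ∘ suc)) ⟩
  sum (map (λ k → (d C k) * h k) (upTo (suc d))) + sum (map (λ k → (d C k) * h (suc k)) (upTo (suc d)))
    ≡⟨ pascal-sum d h ⟨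
  sum (map (λ k → (suc d C k) * h k) (upTo (suc (suc d)))) ∎
  where open ≡-Reasoning

sum-map-pow-#true : ∀ d a → sum (map (λ D → a ^ #true D) (allBoolVecs d)) ≡ suc a ^ d
sum-map-pow-#true zero    a = refl
sum-map-pow-#true (suc d) a = begin
  sum (map (λ D → a ^ #true D) (allBoolVecs (suc d)))
    ≡⟨ sum-map-allBoolVecs-suc d (λ D → a ^ #true D) ⟩
  S + sum (map (λ D → a * a ^ #true D) (allBoolVecs d))
    ≡⟨ cong (S +_) (*-distribˡ-sum-map a (λ D → a ^ #true D) (allBoolVecs d)) ⟨
  S + a * S
    ≡⟨ cong (λ s → s + a * s) (sum-map-pow-#true d a) ⟩
  suc a ^ suc d ∎
  where
  open ≡-Reasoning
  S : ℕ
  S = sum (map (λ D → a ^ #true D) (allBoolVecs d))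

-- Codes of boxes

n<2^n : ∀ k → k < 2 ^ k
n<2^n zero    = s≤s z≤n
n<2^n (suc k) = +-mono-≤ (m^n>0 2 k) (≤-trans (n<2^n k) (m≤m+n (2 ^ k) 0))

m∸n∸1+n≡m∸1 : ∀ {m n} → n < m → m ∸ n ∸ 1 + n ≡ m ∸ 1
m∸n∸1+n≡m∸1 {m} {n} n<m = begin
  m ∸ n ∸ 1 + n    ≡⟨ cong (_+ n) (∸-+-assoc m n 1) ⟩
  m ∸ (n + 1) + n  ≡⟨ cong (λ o → m ∸ o + n) (+-comm n 1) ⟩
  m ∸ (1 + n) + n  ≡⟨ cong (_+ n) (∸-+-assoc m 1 n) ⟨
  m ∸ 1 ∸ n + n    ≡⟨ m∸n+n≡m (∸-monoˡ-≤ 1 n<m) ⟩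
  m ∸ 1            ∎
  where open ≡-Reasoning

*-floorDiv-≤ : ∀ a b → b * floorDiv a b ≤ a
*-floorDiv-≤ a zero    = z≤n
*-floorDiv-≤ a (suc b) = subst (_≤ a) (*-comm (a / suc b) (suc b)) (m/n*n≤m a (suc b))

surplus : ℕ → ℕ → ℕ → ℕ
surplus d n k = (n ∸ 1) ^ (2 ^ k ∸ 1) * (r d n k * (r d n k ∸ 1))

countBound : ℕ → ℕ → ℕ
countBound d n = n ^ d * n ^ d + n * sum (map (λ k → (d C k) * surplus d n k) (upTo (suc d)))

module Codes (m : ℕ) where

  n : ℕ
  n = suc (suc m)

  #relCodes : ∀ {d} → Vec Bool d → ℕ
  #relCodes []          = suc m
  #relCodes (false ∷ D) = #relCodes D
  #relCodes (true ∷ D)  = #relCodes D * #relCodes D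

  #codes : ∀ {d} → Vec Bool d → ℕ
  #codes []          = n
  #codes (false ∷ D) = #codes D
  #codes (true ∷ D)  = #codes D * #relCodes D

  -- b ≠ a as one of the n - 1 symbols other than a; the value for b ≡ a is junk, and it is only
  -- ever compared at positions where the latin property makes the two symbols distinct.
  relSymbol : Fin n → Fin n → Fin (suc m)
  relSymbol a b with a ≟ᶠ b
  ... | yes _  = zero
  ... | no a≢b = punchOut a≢b

  relSymbol-injective : ∀ {a b b′} → a ≢ b → a ≢ b′ → relSymbol a b ≡ relSymbol a b′ → b ≡ b′
  relSymbol-injective {a} {b} {b′} a≢b a≢b′ eq with a ≟ᶠ b | a ≟ᶠ b′
  ... | yes a≡b | _        = ⊥-elim (a≢b a≡b)
  ... | no _    | yes a≡b′ = ⊥-elim (a≢b′ a≡b′)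
  ... | no a≢b  | no a≢b′  = punchOut-injective a≢b a≢b′ eq

  relCode : ∀ {d} → Cube d n → Cube d n → (D : Vec Bool d) → Vec (Fin n × Fin n) d → Fin (#relCodes D)
  relCode q₁ q₂ []          []            = relSymbol (q₁ []) (q₂ [])
  relCode q₁ q₂ (false ∷ D) ((x , _) ∷ t) = relCode (slice q₁ x) (slice q₂ x) D t
  relCode q₁ q₂ (true ∷ D)  ((x , y) ∷ t) =
    combine (relCode (slice q₁ x) (slice q₂ x) D t) (relCode (slice q₁ y) (slice q₂ y) D t)

  code : ∀ {d} → Cube d n → (D : Vec Bool d) → Vec (Fin n × Fin n) d → Fin (#codes D)
  code q []          []            = q []
  code q (false ∷ D) ((x , _) ∷ t) = code (slice q x) D t
  code q (true ∷ D)  ((x , y) ∷ t) = combine (code (slice q x) D t) (relCode (slice q x) (slice q y) D t)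

  relCode-injective : ∀ {d} {D : Vec Bool d} {t t′} (q₁ q₂ q₁′ q₂′ : Cube d n) →
    HasShape D t → HasShape D t′ → (∀ α → q₁ α ≢ q₂ α) → (∀ α → q₁′ α ≢ q₂′ α) →
    (∀ j → q₁ (corner t j) ≡ q₁′ (corner t′ j)) → relCode q₁ q₂ D t ≡ relCode q₁′ q₂′ D t′ →
    ∀ j → q₂ (corner t j) ≡ q₂′ (corner t′ j)
  relCode-injective q₁ q₂ q₁′ q₂′ [] [] sep sep′ agree eq [] =
    relSymbol-injective (subst (_≢ q₂ []) (agree []) (sep [])) (sep′ [])
      (trans (cong (λ a → relSymbol a (q₂ [])) (sym (agree []))) eq)
  relCode-injective q₁ q₂ q₁′ q₂′ (same x s) (same x′ s′) sep sep′ agree eq (zero ∷ j) =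
    relCode-injective (slice q₁ x) (slice q₂ x) (slice q₁′ x′) (slice q₂′ x′) s s′
      (sep ∘ (x ∷_)) (sep′ ∘ (x′ ∷_)) (agree ∘ (zero ∷_)) eq j
  relCode-injective q₁ q₂ q₁′ q₂′ (same x s) (same x′ s′) sep sep′ agree eq (suc i ∷ j) =
    relCode-injective (slice q₁ x) (slice q₂ x) (slice q₁′ x′) (slice q₂′ x′) s s′
      (sep ∘ (x ∷_)) (sep′ ∘ (x′ ∷_)) (agree ∘ (suc i ∷_)) eq j
  relCode-injective {D = true ∷ D} {_ ∷ t} {_ ∷ t′} q₁ q₂ q₁′ q₂′ (distinct x y _ s) (distinct x′ y′ _ s′)
    sep sep′ agree eq = λ where
      (zero  ∷ j) → relCode-injective (slice q₁ x) (slice q₂ x) (slice q₁′ x′) (slice q₂′ x′) s s′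
                      (sep ∘ (x ∷_)) (sep′ ∘ (x′ ∷_)) (agree ∘ (zero ∷_)) (proj₁ eqˣʸ) j
      (suc i ∷ j) → relCode-injective (slice q₁ y) (slice q₂ y) (slice q₁′ y′) (slice q₂′ y′) s s′
                      (sep ∘ (y ∷_)) (sep′ ∘ (y′ ∷_)) (agree ∘ (suc i ∷_)) (proj₂ eqˣʸ) j
    where
    eqˣʸ : relCode (slice q₁ x) (slice q₂ x) D t ≡ relCode (slice q₁′ x′) (slice q₂′ x′) D t′
         × relCode (slice q₁ y) (slice q₂ y) D t ≡ relCode (slice q₁′ y′) (slice q₂′ y′) D t′
    eqˣʸ = combine-injective _ _ _ _ eq

  code-injective : ∀ {d} {D : Vec Bool d} {t t′} {q q′ : Cube d n} →
    HasShape D t → HasShape D t′ → IsLatin q → IsLatin q′ → code q D t ≡ code q′ D t′ →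
    ∀ j → q (corner t j) ≡ q′ (corner t′ j)
  code-injective [] [] _ _ eq [] = eq
  code-injective (same x s) (same x′ s′) latin latin′ eq (zero ∷ j) =
    code-injective s s′ (IsLatin-slice latin x) (IsLatin-slice latin′ x′) eq j
  code-injective (same x s) (same x′ s′) latin latin′ eq (suc _ ∷ j) =
    code-injective s s′ (IsLatin-slice latin x) (IsLatin-slice latin′ x′) eq j
  code-injective {D = true ∷ D} {_ ∷ t} {_ ∷ t′} {q} {q′} (distinct x y x≢y s) (distinct x′ y′ x′≢y′ s′)
    latin latin′ eq = λ where
      (zero  ∷ j) → agreeˣ j
      (suc _ ∷ j) → relCode-injective (slice q x) (slice q y) (slice q′ x′) (slice q′ y′) s s′
                      (λ α → IsLatin-adjacent latin α x≢y) (λ α → IsLatin-adjacent latin′ α x′≢y′)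
                      agreeˣ (proj₂ eqˣʸ) j
    where
    eqˣʸ : code (slice q x) D t ≡ code (slice q′ x′) D t′
         × relCode (slice q x) (slice q y) D t ≡ relCode (slice q′ x′) (slice q′ y′) D t′
    eqˣʸ = combine-injective _ _ _ _ eq
    agreeˣ : ∀ j → q (x ∷ corner t j) ≡ q′ (x′ ∷ corner t′ j)
    agreeˣ = code-injective s s′ (IsLatin-slice latin x) (IsLatin-slice latin′ x′) (proj₁ eqˣʸ)

  #relCodes≡ : ∀ {d} (D : Vec Bool d) → #relCodes D ≡ suc m ^ 2 ^ #true D
  #relCodes≡ []          = sym (*-identityʳ (suc m))
  #relCodes≡ (false ∷ D) = #relCodes≡ D
  #relCodes≡ (true ∷ D)  = begin
    #relCodes D * #relCodes D      ≡⟨ cong₂ _*_ (#relCodes≡ D) (#relCodes≡ D) ⟩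
    suc m ^ 2 ^ k * suc m ^ 2 ^ k  ≡⟨ ^-distribˡ-+-* (suc m) (2 ^ k) (2 ^ k) ⟨
    suc m ^ (2 ^ k + 2 ^ k)        ≡⟨ cong (λ e → suc m ^ (2 ^ k + e)) (+-identityʳ (2 ^ k)) ⟨
    suc m ^ 2 ^ suc k              ∎
    where
    open ≡-Reasoning
    k : ℕ
    k = #true D

  #codes≡ : ∀ {d} (D : Vec Bool d) → #codes D ≡ n * suc m ^ (2 ^ #true D ∸ 1)
  #codes≡ []          = sym (*-identityʳ n)
  #codes≡ (false ∷ D) = #codes≡ D
  #codes≡ (true ∷ D)  = begin
    #codes D * #relCodes D                       ≡⟨ cong₂ _*_ (#codes≡ D) (#relCodes≡ D) ⟩
    n * suc m ^ (2 ^ k ∸ 1) * suc m ^ 2 ^ k      ≡⟨ *-assoc n (suc m ^ (2 ^ k ∸ 1)) (suc m ^ 2 ^ k) ⟩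
    n * (suc m ^ (2 ^ k ∸ 1) * suc m ^ 2 ^ k)    ≡⟨ cong (n *_) (^-distribˡ-+-* (suc m) (2 ^ k ∸ 1) (2 ^ k)) ⟨
    n * suc m ^ (2 ^ k ∸ 1 + 2 ^ k)              ≡⟨ cong (λ e → n * suc m ^ (2 ^ k ∸ 1 + e)) (+-identityʳ (2 ^ k)) ⟨
    n * suc m ^ (2 ^ k ∸ 1 + (2 ^ k + 0))        ≡⟨ cong (λ e → n * suc m ^ e) (+-∸-comm (2 ^ k + 0) (m^n>0 2 k)) ⟨
    n * suc m ^ (2 ^ suc k ∸ 1)                  ∎
    where
    open ≡-Reasoning
    k : ℕ
    k = #true D

  #codes*r≤length-boxes : ∀ {d} (D : Vec Bool (suc d)) →
    #codes D * r (suc d) n (#true D) ≤ length (boxes {suc m} D)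
  #codes*r≤length-boxes {d} D = begin
    #codes D * ρ                           ≡⟨ cong (_* ρ) (#codes≡ D) ⟩
    n * suc m ^ (2 ^ k ∸ 1) * ρ            ≡⟨ cong (λ e → n * suc m ^ e * ρ) (m∸n∸1+n≡m∸1 (n<2^n k)) ⟨
    n * suc m ^ (e + k) * ρ                ≡⟨ cong (λ z → n * z * ρ) (^-distribˡ-+-* (suc m) e k) ⟩
    n * (suc m ^ e * suc m ^ k) * ρ        ≡⟨ regroup n (suc m ^ e) (suc m ^ k) ρ ⟩
    n * (suc m ^ e * ρ) * suc m ^ k        ≤⟨ *-monoˡ-≤ (suc m ^ k) (*-monoʳ-≤ n (*-floorDiv-≤ (n ^ d) (suc m ^ e))) ⟩
    n * n ^ d * suc m ^ k                  ≡⟨ length-boxes D ⟨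
    length (boxes D)                       ∎
    where
    open ≤-Reasoning
    k e ρ : ℕ
    k = #true D
    e = 2 ^ k ∸ k ∸ 1
    ρ = r (suc d) n k
    regroup : ∀ a b c f → a * (b * c) * f ≡ a * (b * f) * c
    regroup = solve-∀

  sum-boxes+surplus≡countBound : ∀ d →
    sum (map (λ D → length (boxes {suc m} D) + #codes D * (r d n (#true D) * (r d n (#true D) ∸ 1))) (allBoolVecs d))
      ≡ countBound d n
  sum-boxes+surplus≡countBound d = begin
    sum (map (λ D → length (boxes D) + #codes D * ρρ D) (allBoolVecs d))
      ≡⟨ sum-map-+ (length ∘ boxes) (λ D → #codes D * ρρ D) (allBoolVecs d) ⟩
    sum (map (length ∘ boxes) (allBoolVecs d)) + sum (map (λ D → #codes D * ρρ D) (allBoolVecs d))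
      ≡⟨ cong₂ _+_ (cong sum (map-cong length-boxes (allBoolVecs d))) (cong sum (map-cong codes*ρρ (allBoolVecs d))) ⟩
    sum (map (λ D → n ^ d * suc m ^ #true D) (allBoolVecs d)) + sum (map (λ D → n * surplus d n (#true D)) (allBoolVecs d))
      ≡⟨ cong₂ _+_ (*-distribˡ-sum-map (n ^ d) _ (allBoolVecs d)) (*-distribˡ-sum-map n _ (allBoolVecs d)) ⟨
    n ^ d * sum (map (λ D → suc m ^ #true D) (allBoolVecs d)) + n * sum (map (surplus d n ∘ #true) (allBoolVecs d))
      ≡⟨ cong₂ (λ a b → n ^ d * a + n * b) (sum-map-pow-#true d (suc m)) (binomial-sum d (surplus d n)) ⟩
    countBound d n ∎
    where
    open ≡-Reasoning
    ρρ : Vec Bool d → ℕ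
    ρρ D = r d n (#true D) * (r d n (#true D) ∸ 1)
    codes*ρρ : ∀ D → #codes D * ρρ D ≡ n * surplus d n (#true D)
    codes*ρρ D = trans (cong (_* ρρ D) (#codes≡ D)) (*-assoc n (suc m ^ (2 ^ #true D ∸ 1)) (ρρ D))

  module _ {d} (q : Cube d n) where
    open Fibres

    cuboctahedraOfShape : Vec Bool d → List (Tuple d n)
    cuboctahedraOfShape D = sameFibrePairs (code q D) (boxes D)

    cuboctahedra : List (Tuple d n)
    cuboctahedra = concatMap cuboctahedraOfShape (allBoolVecs d)

    cuboctahedra-unique : Unique cuboctahedra
    cuboctahedra-unique = Unique-concatMap cuboctahedraOfShape (shapeOf ∘ proj₁) (allBoolVecs-unique d)
      (λ D → sameFibrePairs-unique (code q D) (boxes-unique D))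
      (λ D → All.map (λ (shaped , _ , _) → shapeOf-HasShape shaped) (sameFibrePairs⁺ (code q D) (boxes-HasShape D)))

    cuboctahedra-IsCuboctahedron : IsLatin q → All (IsCuboctahedron q) cuboctahedra
    cuboctahedra-IsCuboctahedron latin = All.concat⁺ (All.map⁺ (All.universal
      (λ D → All.map (λ (shapedᵃ , shapedᵇ , sameCode) → code-injective shapedᵃ shapedᵇ latin latin (sym sameCode))
                     (sameFibrePairs⁺ (code q D) (boxes-HasShape D)))
      (allBoolVecs d)))

    length-cuboctahedra-≥ : (ρ : Vec Bool d → ℕ) → (∀ D → #codes D * ρ D ≤ length (boxes {suc m} D)) →
      sum (map (λ D → length (boxes {suc m} D) + #codes D * (ρ D * (ρ D ∸ 1))) (allBoolVecs d)) ≤ length cuboctahedra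
    length-cuboctahedra-≥ ρ fits = begin
      sum (map (λ D → length (boxes D) + #codes D * (ρ D * (ρ D ∸ 1))) (allBoolVecs d))
        ≤⟨ sum-map-mono-≤ (λ D → sameFibrePairs-length-≥ (code q D) (boxes D) (ρ D) (fits D)) (allBoolVecs d) ⟩
      sum (map (length ∘ cuboctahedraOfShape) (allBoolVecs d))
        ≡⟨ length-concatMap cuboctahedraOfShape (allBoolVecs d) ⟨
      length cuboctahedra ∎
      where open ≤-Reasoning

  countBound≤length-cuboctahedra : ∀ {d} (q : Cube (suc d) n) → countBound (suc d) n ≤ length (cuboctahedra q)
  countBound≤length-cuboctahedra {d} q = subst (_≤ length (cuboctahedra q)) (sum-boxes+surplus≡countBound (suc d))
    (length-cuboctahedra-≥ q (r (suc d) n ∘ #true) #codes*r≤length-boxes)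

-- Comparison with the stated bound

open import Data.Integer as ℤ using (ℤ; +_)
import Data.Integer.Properties as ℤ
open import Data.Integer.Tactic.RingSolver using () renaming (solve-∀ to solve-∀-ℤ)

countBound-identity : ∀ e m →
  let d = 2 + e
      n = 2 + m
      S = sum (map (λ k → (d C k) * surplus d n k) (drop 2 (upTo (suc d))))
  in countBound d n + (d ∸ 1) * (n ^ (2 * d ∸ 1) + n ^ d) + d * n ^ suc d
       ≡ suc d * n ^ (2 * d) + n * S + 2 * (d ∸ 1) * n ^ d
countBound-identity e m = begin
  countBound d n + suc e * (n ^ (2 * d ∸ 1) + n * A) + d * (n * (n * A))
    ≡⟨ cong₂ (λ c p → c + suc e * (p + n * A) + d * (n * (n * A))) countBound≡ n^[2d∸1]≡ ⟩
  n * A * (n * A) + n * (A * (A ∸ 1) + (d * (suc m * (A * (A ∸ 1))) + S)) + suc e * (A * (n * A) + n * A) + d * (n * (n * A))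
    ≡⟨ expand A (m^n>0 n (suc e)) ⟩
  suc d * (n * A * (n * A)) + n * S + 2 * suc e * (n * A)
    ≡⟨ cong (λ p → suc d * p + n * S + 2 * suc e * (n * A)) n^[2d]≡ ⟨
  suc d * n ^ (2 * d) + n * S + 2 * suc e * (n * A) ∎
  where
  open ≡-Reasoning
  d n A S : ℕ
  d = 2 + e
  n = 2 + m
  A = n ^ suc e
  S = sum (map (λ k → (d C k) * surplus d n k) (drop 2 (upTo (suc d))))
  countBound≡ : countBound d n ≡ n * A * (n * A) + n * (A * (A ∸ 1) + (d * (suc m * (A * (A ∸ 1))) + S))
  countBound≡ = cong (λ s → n * A * (n * A) + n * s) (cong₂ _+_ first (cong (_+ S) second))
    where
    first : (d C 0) * surplus d n 0 ≡ A * (A ∸ 1)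
    first = trans (*-identityˡ _) (trans (*-identityˡ _) (cong (λ a → a * (a ∸ 1)) (n/1≡n A)))
    second : (d C 1) * surplus d n 1 ≡ d * (suc m * (A * (A ∸ 1)))
    second = cong₂ _*_ (nC1≡n d) (cong₂ _*_ (*-identityʳ (suc m)) (cong (λ a → a * (a ∸ 1)) (n/1≡n A)))
  n^[2d∸1]≡ : n ^ (2 * d ∸ 1) ≡ A * (n * A)
  n^[2d∸1]≡ = trans (^-distribˡ-+-* n (suc e) (d + 0)) (cong (λ k → A * n ^ k) (+-identityʳ d))
  n^[2d]≡ : n ^ (2 * d) ≡ n * A * (n * A)
  n^[2d]≡ = trans (^-distribˡ-+-* n d (d + 0)) (cong (λ k → n * A * n ^ k) (+-identityʳ d))
  expand : ∀ A → 0 < A →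
    n * A * (n * A) + n * (A * (A ∸ 1) + (d * (suc m * (A * (A ∸ 1))) + S)) + suc e * (A * (n * A) + n * A) + d * (n * (n * A))
      ≡ suc d * (n * A * (n * A)) + n * S + 2 * suc e * (n * A)
  expand (suc A′) _ = polynomial m e A′ S
    where
    polynomial : ∀ m e A′ S →
      (2 + m) * suc A′ * ((2 + m) * suc A′) + (2 + m) * (suc A′ * A′ + ((2 + e) * (suc m * (suc A′ * A′)) + S))
        + suc e * (suc A′ * ((2 + m) * suc A′) + (2 + m) * suc A′) + (2 + e) * ((2 + m) * ((2 + m) * suc A′))
      ≡ suc (2 + e) * ((2 + m) * suc A′ * ((2 + m) * suc A′)) + (2 + m) * S + 2 * suc e * ((2 + m) * suc A′)
    polynomial = solve-∀


+[m*[m∸1]]≡+m*[+m-+1] : ∀ x → + (x * (x ∸ 1)) ≡ + x ℤ.* (+ x ℤ.- + 1)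
+[m*[m∸1]]≡+m*[+m-+1] zero    = refl
+[m*[m∸1]]≡+m*[+m-+1] (suc x) = ℤ.pos-* (suc x) x

term≤+[C*surplus] : ∀ {d} n k → 1 ≤ d → term d n k ℤ.≤ + ((d C k) * surplus d n k)
term≤+[C*surplus] {d} n k 1≤d = begin
  term d n k                           ≡⟨ cong (+ c ℤ.* + p ℤ.*_) (+[m*[m∸1]]≡+m*[+m-+1] ρ) ⟨
  + c ℤ.* + p ℤ.* + (ρ * (ρ ∸ 1))      ≡⟨ cong (ℤ._* + (ρ * (ρ ∸ 1))) (ℤ.pos-* c p) ⟨
  + (c * p) ℤ.* + (ρ * (ρ ∸ 1))        ≡⟨ ℤ.pos-* (c * p) (ρ * (ρ ∸ 1)) ⟨
  + (c * p * (ρ * (ρ ∸ 1)))            ≤⟨ ℤ.+≤+ (≤-trans (*-monoˡ-≤ (ρ * (ρ ∸ 1)) (*-monoʳ-≤ c n∸d^e≤n∸1^e))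
                                                       (≤-reflexive (*-assoc c _ (ρ * (ρ ∸ 1))))) ⟩
  + (c * surplus d n k)                ∎
  where
  open ℤ.≤-Reasoning
  c ρ p : ℕ
  c = d C k
  ρ = r d n k
  p = (n ∸ d) ^ (2 ^ k ∸ 1)
  n∸d^e≤n∸1^e : (n ∸ d) ^ (2 ^ k ∸ 1) ≤ (n ∸ 1) ^ (2 ^ k ∸ 1)
  n∸d^e≤n∸1^e = ^-monoˡ-≤ (2 ^ k ∸ 1) (∸-monoʳ-≤ n 1≤d)

sumℤ-map-≤ : ∀ {A : Set} {f : A → ℤ} {g : A → ℕ} → (∀ x → f x ℤ.≤ + g x) →
  ∀ xs → sumℤ (map f xs) ℤ.≤ + sum (map g xs)
sumℤ-map-≤ f≤g []       = ℤ.≤-refl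
sumℤ-map-≤ {f = f} {g} f≤g (x ∷ xs) =
  subst (sumℤ (map f (x ∷ xs)) ℤ.≤_) (sym (ℤ.pos-+ (g x) (sum (map g xs)))) (ℤ.+-mono-≤ (f≤g x) (sumℤ-map-≤ f≤g xs))

+u-+v-+w++p≤+l : ∀ u v w p s l → l + v + w ≡ u + p + s → + u ℤ.- + v ℤ.- + w ℤ.+ + p ℤ.≤ + l
+u-+v-+w++p≤+l u v w p s l eq = begin
  + u ℤ.- + v ℤ.- + w ℤ.+ + p                  ≤⟨ ℤ.i≤i+j _ (+ s) ⟩
  + u ℤ.- + v ℤ.- + w ℤ.+ + p ℤ.+ + s          ≡⟨ shuffle (+ u) (+ v) (+ w) (+ p) (+ s) ⟩
  (+ u ℤ.+ + p ℤ.+ + s) ℤ.- + v ℤ.- + w        ≡⟨ cong (λ i → i ℤ.- + v ℤ.- + w) (trans (sym (pos-+₃ u p s)) (trans (cong +_ (sym eq)) (pos-+₃ l v w))) ⟩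
  (+ l ℤ.+ + v ℤ.+ + w) ℤ.- + v ℤ.- + w        ≡⟨ cancel (+ l) (+ v) (+ w) ⟩
  + l                                           ∎
  where
  open ℤ.≤-Reasoning
  pos-+₃ : ∀ a b c → + (a + b + c) ≡ + a ℤ.+ + b ℤ.+ + c
  pos-+₃ a b c = trans (ℤ.pos-+ (a + b) c) (cong (ℤ._+ + c) (ℤ.pos-+ a b))
  shuffle : ∀ a b c e f → a ℤ.- b ℤ.- c ℤ.+ e ℤ.+ f ≡ (a ℤ.+ e ℤ.+ f) ℤ.- b ℤ.- c
  shuffle = solve-∀-ℤ
  cancel : ∀ a b c → (a ℤ.+ b ℤ.+ c) ℤ.- b ℤ.- c ≡ a
  cancel = solve-∀-ℤ

bound≤countBound : ∀ e m → bound (2 + e) (2 + m) ℤ.≤ + countBound (2 + e) (2 + m)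
bound≤countBound e m = begin
  bound d n
    ≤⟨ ℤ.+-monoʳ-≤ (+ U ℤ.- + suc e ℤ.* (+ P ℤ.+ + Q) ℤ.- + d ℤ.* + R)
         (ℤ.*-monoˡ-≤-nonNeg (+ n) (sumℤ-map-≤ (λ k → term≤+[C*surplus] {d} n k (s≤s z≤n)) (drop 2 (upTo (suc d))))) ⟩
  + U ℤ.- + suc e ℤ.* (+ P ℤ.+ + Q) ℤ.- + d ℤ.* + R ℤ.+ + n ℤ.* + S
    ≡⟨ cong (λ i → + U ℤ.- + suc e ℤ.* i ℤ.- + d ℤ.* + R ℤ.+ + n ℤ.* + S) (ℤ.pos-+ P Q) ⟨
  + U ℤ.- + suc e ℤ.* + (P + Q) ℤ.- + d ℤ.* + R ℤ.+ + n ℤ.* + S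
    ≡⟨ cong₂ (λ i j → + U ℤ.- i ℤ.- j ℤ.+ + n ℤ.* + S) (ℤ.pos-* (suc e) (P + Q)) (ℤ.pos-* d R) ⟨
  + U ℤ.- + (suc e * (P + Q)) ℤ.- + (d * R) ℤ.+ + n ℤ.* + S
    ≡⟨ cong (λ i → + U ℤ.- + (suc e * (P + Q)) ℤ.- + (d * R) ℤ.+ i) (ℤ.pos-* n S) ⟨
  + U ℤ.- + (suc e * (P + Q)) ℤ.- + (d * R) ℤ.+ + (n * S)
    ≤⟨ +u-+v-+w++p≤+l U _ _ _ _ (countBound d n) (countBound-identity e m) ⟩
  + countBound d n ∎
  where
  open ℤ.≤-Reasoning
  d n U P Q R S : ℕ
  d = 2 + e
  n = 2 + m
  U = suc d * n ^ (2 * d)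
  P = n ^ (2 * d ∸ 1)
  Q = n ^ d
  R = n ^ suc d
  S = sum (map (λ k → (d C k) * surplus d n k) (drop 2 (upTo (suc d))))

theorem5 : (d n : ℕ) → 3 ≤ d → d < n → (Q : LatinHypercube d n) →
    ∃ λ (L : List (Tuple d n)) →
    Unique L × All (IsCuboctahedron (proj₁ Q)) L × bound d n ℤ.≤ + length L
theorem5 (suc (suc (suc e))) (suc (suc m)) (s≤s (s≤s (s≤s z≤n))) _ (q , latin) =
  cuboctahedra q , cuboctahedra-unique q , cuboctahedra-IsCuboctahedron q latin ,
  ℤ.≤-trans (bound≤countBound (suc e) m) (ℤ.+≤+ (countBound≤length-cuboctahedra q))
  where open Codes m
theorem5 (suc (suc (suc _))) (suc zero) (s≤s (s≤s (s≤s z≤n))) (s≤s ())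
theorem5 (suc (suc (suc _))) zero      (s≤s (s≤s (s≤s z≤n))) ()
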